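{- Let $\mathbb{P}^*$ be the set of all finite words $w=w(1)w(2)\cdots w(n)$ ($n\ge 0$) with letters in the positive integers $\mathbb{P}$ (i.e. integer compositions), partially ordered by $u\le w$ iff $w$ has a subword $w(i_1)w(i_2)\cdots w(i_l)$, $i_1<\dots<i_l$, $l=|u|$, with $u(j)\le w(i_j)$ for $1\le j\le l$. Then for all $u,w\in\mathbb{P}^*$ with $u\le w$, $$\mu(u,w)=\sum_{\eta_u}(-1)^{d(\eta_u)},$$ where $\mu$ is the Möbius function of $\mathbb{P}^*$ and the sum is over all normal embeddings $\eta_u$ of $u$ into $w$.
   Context: $|w|$ denotes the length of a word. For a word $\eta$ over the nonnegative integers, $\operatorname{Supp}\eta=\{i:\eta(i)\neq 0\}$. An expansion of $u$ is a word $\eta_u$ over the nonnegative integers whose restriction to its support (deleting all zeros) equals $u$. An embedding of $u$ into $w$ is an expansion $\eta_u$ of $u$ of length $|w|$ with $\eta_u(i)\le w(i)$ for $1\le i\le |w|$. A run of $k$'s in $w$ is a maximal interval of indices $[r,t]$ with $w(r)=w(r+1)=\dots=w(t)=k$. An embedding $\eta_u$ of $u$ into $w$ is normal if (1) for each $1\le i\le |w|$, $\eta_u(i)\in\{w(i),w(i)-1,0\}$; and (2) for every $k\ge1$ and every run $[r,t]$ of $k$'s in $w$: if $k=1$ then $(r,t]=\{r+1,\dots,t\}\subseteq\operatorname{Supp}\eta_u$, and if $k\ge2$ then $r\in\operatorname{Supp}\eta_u$. The defect of a normal embedding is $d(\eta_u)=\#\{i:\eta_u(i)=w(i)-1\}$.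 -}

module Defs where

open import Data.Nat as ℕ using (ℕ; zero; suc; _≤_; _<_; _∸_; _⊔_; _≟_)
open import Data.Nat.Properties using (_≤?_)
open import Data.Integer as ℤ using (ℤ; 0ℤ; 1ℤ; -_; -1ℤ)
open import Data.List using (List; []; _∷_; length; map; filter; concatMap; upTo; foldr)
open import Data.Nat.ListAction using (sum)
open import Data.List.Properties using (≡-dec)
open import Data.List.Relation.Unary.All using (All)
open import Data.List.Relation.Binary.Pointwise using (Pointwise)
open import Data.Product using (_×_; _,_)
open import Data.Sum using (_⊎_)
open import Relation.Nullary using (Dec; yes; no; ¬_; ¬?)
open import Relation.Nullary.Decidable using (_×-dec_; _⊎-dec_; map′)
open import Relation.Binary.PropositionalEquality using (_≡_; _≢_)

Word : Set
Word = List ℕ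

Composition : Word → Set
Composition w = All (1 ≤_) w

infix 4 _≼_
data _≼_ : Word → Word → Set where
  []≼  : ∀ {w} → [] ≼ w
  keep : ∀ {a b u w} → a ≤ b → u ≼ w → (a ∷ u) ≼ (b ∷ w)
  skip : ∀ {u b w} → u ≼ w → u ≼ (b ∷ w)

_≼?_ : (u w : Word) → Dec (u ≼ w)
[] ≼? w = yes []≼
(a ∷ u) ≼? [] = no λ ()
(a ∷ u) ≼? (b ∷ w) with (a ≤? b ×-dec u ≼? w) ⊎-dec ((a ∷ u) ≼? w)
... | yes (Data.Sum.inj₁ (p , q)) = yes (keep p q)
... | yes (Data.Sum.inj₂ q) = yes (skip q)
... | no ¬r = no λ { (keep p q) → ¬r (Data.Sum.inj₁ (p , q))
                   ; (skip q) → ¬r (Data.Sum.inj₂ q) }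

_≟w_ : (u w : Word) → Dec (u ≡ w)
_≟w_ = ≡-dec _≟_

-- Finite enumeration of intervals [u,w] of ℙ*.
-- Every v ≼ w has |v| ≤ |w| and letters ≤ max w, so it suffices to
-- enumerate words of length ≤ |w| with letters in {1,…,max w}.

letters : ℕ → List ℕ
letters m = map suc (upTo m)

wordsLen : ℕ → ℕ → List Word
wordsLen m zero = [] ∷ []
wordsLen m (suc k) = concatMap (λ a → map (a ∷_) (wordsLen m k)) (letters m)

wordsUpTo : ℕ → ℕ → List Word
wordsUpTo m n = concatMap (wordsLen m) (upTo (suc n))

maxL : Word → ℕ
maxL = foldr _⊔_ 0

interval : Word → Word → List Word
interval u w = filter (λ v → (u ≼? v) ×-dec (v ≼? w)) (wordsUpTo (maxL w) (length w))

sumℤ : List ℤ → ℤ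
sumℤ = foldr ℤ._+_ 0ℤ

-- The recursion is run with fuel |w| + Σ w + 1, which is enough since
-- |v| + Σ v strictly increases along strict relations v ≺ v'.

mobiusF : ℕ → Word → Word → ℤ
mobiusF zero u w = 0ℤ
mobiusF (suc f) u w with u ≟w w
... | yes _ = 1ℤ
... | no  _ = - sumℤ (map (mobiusF f u) (filter (λ v → ¬? (v ≟w w)) (interval u w)))

μ : Word → Word → ℤ
μ u w = mobiusF (suc (length w ℕ.+ sum w)) u w

deleteZeros : Word → Word
deleteZeros [] = []
deleteZeros (zero ∷ η) = deleteZeros η
deleteZeros (suc a ∷ η) = suc a ∷ deleteZeros η

IsExpansion : Word → Word → Set
IsExpansion u η = deleteZeros η ≡ u

IsEmbedding : Word → Word → Word → Set
IsEmbedding u w η = IsExpansion u η × Pointwise _≤_ η w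

-- 1-based letter access (0 outside 1..|w|)
at : Word → ℕ → ℕ
at [] i = 0
at (a ∷ w) zero = 0
at (a ∷ w) (suc zero) = a
at (a ∷ w) (suc (suc i)) = at w (suc i)

IsRun : Word → ℕ → ℕ → ℕ → Set
IsRun w k r t =
  1 ≤ r × r ≤ t × t ≤ length w ×
  (∀ i → r ≤ i → i ≤ t → at w i ≡ k) ×
  (r ≡ 1 ⊎ at w (r ∸ 1) ≢ k) ×
  (t ≡ length w ⊎ at w (suc t) ≢ k)

InSupp : Word → ℕ → Set
InSupp η i = at η i ≢ 0

IsNormalEmbedding : Word → Word → Word → Set
IsNormalEmbedding u w η =
  IsEmbedding u w η ×
  (∀ i → 1 ≤ i → i ≤ length w →
     at η i ≡ at w i ⊎ at η i ≡ at w i ∸ 1 ⊎ at η i ≡ 0) ×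
  (∀ k r t → 1 ≤ k → IsRun w k r t →
     (k ≡ 1 → ∀ i → r < i → i ≤ t → InSupp η i) ×
     (2 ≤ k → InSupp η r))

defect : Word → Word → ℕ
defect [] _ = 0
defect (_ ∷ _) [] = 0
defect (e ∷ η) (a ∷ w) with e ≟ a ∸ 1
... | yes _ = suc (defect η w)
... | no  _ = defect η w

sign : ℕ → ℤ
sign d = -1ℤ ℤ.^ d

-- Whether a letter of an embedding η of u into w is allowed depends only on the letter of w
-- under it, on the letter of w before that one (0 at the start), and on the letter of η.
-- So let normalSum p u v be the signed count of the embeddings of u into v that are normal
-- when v is preceded by the letter p; the theorem is about normalSum 0 u w.  As μ(u, ·) is
-- the only function vanishing off {v : u ≼ v} whose sum over each lower interval [u, w] is
-- δ(u, w), it suffices to show, for all p and by induction on w,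
--   Σ_{v ≼ w} normalSum p u v  =  [u = w] + Σ_{w = x c y, 1 ≤ p ≤ c} [u = y],
-- which is δ(u, w) for p = 0.  The words below b w′ but not below w′ are the a v′ with a ≤ b,
-- v′ ≼ w′ and a v′ ⋠ w′.  The suffix term is the sum over the a v′ ≼ w′, so by induction the
-- sum of normalSum a u′ v′ over these v′ is [u′ = w′].  Expanding normalSum p u (a v′) by the
-- letter e that η puts under a therefore leaves Σ_e c_e [u = e w′] (0 w′ meaning w′), where
-- c_e = [e = a] − [e = a − 1] + [e = 0][p = a] is the signed weight of that letter, and this
-- telescopes over a = 1, …, b to [u = b w′] − [u = w′] + [1 ≤ p ≤ b][u = w′].

module Submission where

open import Defs
open import Data.Bool using (if_then_else_)
open import Data.Empty using (⊥)
open import Data.Integer as ℤ using (ℤ; 0ℤ; 1ℤ; -1ℤ; _+_; _*_; -_; _-_)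
import Data.Integer.Properties as ℤ
open import Data.Integer.Tactic.RingSolver using (solve-∀)
open import Data.List using (List; []; _∷_; length; map; filter; concatMap; upTo; applyUpTo; _++_)
import Data.List.Properties as List
open import Data.List.Membership.Propositional using (_∈_; _∉_)
open import Data.List.Membership.DecPropositional _≟w_ using (_∈?_)
open import Data.List.Relation.Binary.Pointwise using (Pointwise; []; _∷_)
import Data.List.Relation.Binary.Pointwise.Properties as Pointwise
open import Data.List.Relation.Unary.All as All using (All; []; _∷_)
open import Data.List.Relation.Unary.All.Properties using (All¬⇒¬Any)
open import Data.List.Relation.Unary.AllPairs using (_∷_)
open import Data.List.Relation.Unary.Any using (here; there)
open import Data.List.Relation.Unary.Unique.Propositional using (Unique)
open import Data.Nat as ℕ using (ℕ; zero; suc; _≤_; _<_; _∸_; s≤s; z≤n; _≟_; _≤?_; _<?_)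
import Data.Nat.Properties as ℕ
open import Data.Nat.ListAction using (sum)
open import Data.Product using (_×_; _,_; proj₁; proj₂; ∃-syntax)
open import Data.Sum using (_⊎_; inj₁; inj₂)
open import Data.Unit using (⊤; tt)
open import Function using (_∘_)
open import Function.Bundles using (_⇔_; mk⇔; Equivalence)
open import Level using (Level)
open import Relation.Nullary using (Dec; does; yes; no; ¬_; ¬?; contradiction)
open import Relation.Nullary.Decidable using (_×-dec_; _⊎-dec_; _→-dec_; decidable-stable)
open import Relation.Binary.PropositionalEquality using (_≡_; _≢_; refl; sym; trans; cong; cong₂; subst)
open Relation.Binary.PropositionalEquality.≡-Reasoning
import Algebra.Properties.CommutativeSemigroup as CommutativeSemigroup

private
  module ℕ+ = CommutativeSemigroup ℕ.+-commutativeSemigroup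
  module ℤ+ = CommutativeSemigroup ℤ.+-commutativeSemigroup
  module ℤ* = CommutativeSemigroup ℤ.*-commutativeSemigroup

private variable
  ℓ ℓ′ : Level
  P : Set ℓ
  Q : Set ℓ′

𝟙 : Dec P → ℤ
𝟙 d = if does d then 1ℤ else 0ℤ

𝟙-yes : (d : Dec P) → P → 𝟙 d ≡ 1ℤ
𝟙-yes (yes _) _  = refl
𝟙-yes (no ¬p) p = contradiction p ¬p

𝟙-no : (d : Dec P) → ¬ P → 𝟙 d ≡ 0ℤ
𝟙-no (yes p) ¬p = contradiction p ¬p
𝟙-no (no _)  _  = refl

𝟙-*-yes : (d : Dec P) → P → ∀ x → 𝟙 d * x ≡ x
𝟙-*-yes d p x = trans (cong (_* x) (𝟙-yes d p)) (ℤ.*-identityˡ x)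

𝟙-*-no : (d : Dec P) → ¬ P → ∀ x → 𝟙 d * x ≡ 0ℤ
𝟙-*-no d ¬p x = trans (cong (_* x) (𝟙-no d ¬p)) (ℤ.*-zeroˡ x)

𝟙-⇔ : (P → Q) → (Q → P) → (d : Dec P) (d′ : Dec Q) → 𝟙 d ≡ 𝟙 d′
𝟙-⇔ f g (yes p) d′ = sym (𝟙-yes d′ (f p))
𝟙-⇔ f g (no ¬p) d′ = sym (𝟙-no d′ (¬p ∘ g))

𝟙-× : (d : Dec P) (d′ : Dec Q) → 𝟙 (d ×-dec d′) ≡ 𝟙 d * 𝟙 d′
𝟙-× (yes _) (yes _) = refl
𝟙-× (yes _) (no _)  = refl
𝟙-× (no _)  (yes _) = refl
𝟙-× (no _)  (no _)  = refl

∑< : ℕ → (ℕ → ℤ) → ℤ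
∑< k f = sumℤ (applyUpTo f k)

syntax ∑< k (λ i → e) = ∑[ i < k ] e

∑<-cong : ∀ k {f g : ℕ → ℤ} → (∀ i → i < k → f i ≡ g i) → ∑< k f ≡ ∑< k g
∑<-cong zero    eq = refl
∑<-cong (suc k) eq = cong₂ _+_ (eq 0 (s≤s z≤n)) (∑<-cong k (λ i i<k → eq (suc i) (s≤s i<k)))

∑<-vanish : ∀ k {f : ℕ → ℤ} → (∀ i → i < k → f i ≡ 0ℤ) → ∑< k f ≡ 0ℤ
∑<-vanish zero    eq = refl
∑<-vanish (suc k) eq = cong₂ _+_ (eq 0 (s≤s z≤n)) (∑<-vanish k (λ i i<k → eq (suc i) (s≤s i<k)))

∑<-+ : ∀ k (f g : ℕ → ℤ) → ∑[ i < k ] (f i + g i) ≡ ∑< k f + ∑< k g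
∑<-+ zero    f g = refl
∑<-+ (suc k) f g = begin
  f 0 + g 0 + ∑[ i < k ] (f (suc i) + g (suc i))  ≡⟨ cong (f 0 + g 0 +_) (∑<-+ k (f ∘ suc) (g ∘ suc)) ⟩
  f 0 + g 0 + (∑< k (f ∘ suc) + ∑< k (g ∘ suc))    ≡⟨ ℤ+.interchange (f 0) (g 0) _ _ ⟩
  f 0 + ∑< k (f ∘ suc) + (g 0 + ∑< k (g ∘ suc))    ∎

∑<-- : ∀ k (f g : ℕ → ℤ) → ∑[ i < k ] (f i - g i) ≡ ∑< k f - ∑< k g
∑<-- zero    f g = refl
∑<-- (suc k) f g = begin
  f 0 - g 0 + ∑[ i < k ] (f (suc i) - g (suc i))  ≡⟨ cong (f 0 - g 0 +_) (∑<-- k (f ∘ suc) (g ∘ suc)) ⟩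
  f 0 - g 0 + (∑< k (f ∘ suc) - ∑< k (g ∘ suc))    ≡⟨ interchange (f 0) (g 0) _ _ ⟩
  f 0 + ∑< k (f ∘ suc) - (g 0 + ∑< k (g ∘ suc))    ∎
  where
  interchange : ∀ a b c d → a - b + (c - d) ≡ a + c - (b + d)
  interchange = solve-∀

∑<-*ˡ : ∀ c k (f : ℕ → ℤ) → ∑[ i < k ] (c * f i) ≡ c * ∑< k f
∑<-*ˡ c zero    f = sym (ℤ.*-zeroʳ c)
∑<-*ˡ c (suc k) f = trans (cong (c * f 0 +_) (∑<-*ˡ c k (f ∘ suc)))
                          (sym (ℤ.*-distribˡ-+ c (f 0) (∑< k (f ∘ suc))))

∑<-*ʳ : ∀ c k (f : ℕ → ℤ) → ∑[ i < k ] (f i * c) ≡ ∑< k f * c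
∑<-*ʳ c zero    f = refl
∑<-*ʳ c (suc k) f = trans (cong (f 0 * c +_) (∑<-*ʳ c k (f ∘ suc)))
                          (sym (ℤ.*-distribʳ-+ c (f 0) (∑< k (f ∘ suc))))

∑<-swap : ∀ k l (f : ℕ → ℕ → ℤ) → ∑[ i < k ] ∑[ j < l ] f i j ≡ ∑[ j < l ] ∑[ i < k ] f i j
∑<-swap zero    l f = sym (∑<-vanish l (λ _ _ → refl))
∑<-swap (suc k) l f = trans (cong (∑< l (f 0) +_) (∑<-swap k l (f ∘ suc)))
                            (sym (∑<-+ l (f 0) (λ j → ∑[ i < k ] f (suc i) j)))

∑<-single : ∀ k (f : ℕ → ℤ) x → x < k → (∀ i → i ≢ x → f i ≡ 0ℤ) → ∑< k f ≡ f x
∑<-single (suc k) f zero    _         off = begin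
  f 0 + ∑< k (f ∘ suc)  ≡⟨ cong (f 0 +_) (∑<-vanish k (λ i _ → off (suc i) λ ())) ⟩
  f 0 + 0ℤ              ≡⟨ ℤ.+-identityʳ (f 0) ⟩
  f 0                   ∎
∑<-single (suc k) f (suc x) (s≤s x<k) off = begin
  f 0 + ∑< k (f ∘ suc)  ≡⟨ cong (_+ ∑< k (f ∘ suc)) (off 0 λ ()) ⟩
  0ℤ + ∑< k (f ∘ suc)   ≡⟨ ℤ.+-identityˡ _ ⟩
  ∑< k (f ∘ suc)        ≡⟨ ∑<-single k (f ∘ suc) x x<k (λ i i≢x → off (suc i) (i≢x ∘ ℕ.suc-injective)) ⟩
  f (suc x)             ∎

∑<-truncate : ∀ k b (f : ℕ → ℤ) → b ≤ k → (∀ i → b ≤ i → f i ≡ 0ℤ) → ∑< k f ≡ ∑< b f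
∑<-truncate k       zero    f _         off = ∑<-vanish k (λ i _ → off i z≤n)
∑<-truncate (suc k) (suc b) f (s≤s b≤k) off =
  cong (f 0 +_) (∑<-truncate k b (f ∘ suc) b≤k (λ i b≤i → off (suc i) (s≤s b≤i)))

∑<-telescope : ∀ k (E : ℕ → ℤ) → ∑[ i < k ] (E (suc i) - E i) ≡ E k - E 0
∑<-telescope zero    E = sym (ℤ.+-inverseʳ (E 0))
∑<-telescope (suc k) E =
  trans (cong (E 1 - E 0 +_) (∑<-telescope k (E ∘ suc))) (collapse (E 0) (E 1) (E (suc k)))
  where
  collapse : ∀ a b c → b - a + (c - b) ≡ c - a
  collapse = solve-∀

sumℤ-++ : ∀ xs ys → sumℤ (xs ++ ys) ≡ sumℤ xs + sumℤ ys
sumℤ-++ []       ys = sym (ℤ.+-identityˡ (sumℤ ys))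
sumℤ-++ (x ∷ xs) ys = trans (cong (x +_) (sumℤ-++ xs ys)) (sym (ℤ.+-assoc x (sumℤ xs) (sumℤ ys)))

sumℤ-concatMap : ∀ {A B : Set} (g : B → ℤ) (h : A → List B) xs →
                 sumℤ (map g (concatMap h xs)) ≡ sumℤ (map (λ x → sumℤ (map g (h x))) xs)
sumℤ-concatMap g h []       = refl
sumℤ-concatMap g h (x ∷ xs) = begin
  sumℤ (map g (h x ++ concatMap h xs))
    ≡⟨ cong sumℤ (List.map-++ g (h x) (concatMap h xs)) ⟩
  sumℤ (map g (h x) ++ map g (concatMap h xs))
    ≡⟨ sumℤ-++ (map g (h x)) _ ⟩
  sumℤ (map g (h x)) + sumℤ (map g (concatMap h xs))
    ≡⟨ cong (sumℤ (map g (h x)) +_) (sumℤ-concatMap g h xs) ⟩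
  sumℤ (map g (h x)) + sumℤ (map (λ x → sumℤ (map g (h x))) xs) ∎

sumℤ-map-upTo : ∀ k (f : ℕ → ℤ) → sumℤ (map f (upTo k)) ≡ ∑< k f
sumℤ-map-upTo k f = cong sumℤ (List.map-upTo f k)

sumℤ-filter : ∀ {A : Set} {P : A → Set} (P? : ∀ x → Dec (P x)) (g : A → ℤ) xs →
              sumℤ (map g (filter P? xs)) ≡ sumℤ (map (λ x → 𝟙 (P? x) * g x) xs)
sumℤ-filter P? g []       = refl
sumℤ-filter P? g (x ∷ xs) with P? x
... | yes _ = cong₂ _+_ (sym (ℤ.*-identityˡ (g x))) (sumℤ-filter P? g xs)
... | no _  = trans (sumℤ-filter P? g xs) (sym (ℤ.+-identityˡ _))

∑W : ℕ → ℕ → (Word → ℤ) → ℤ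
∑W m zero    f = f []
∑W m (suc n) f = f [] + ∑[ i < m ] ∑W m n (λ v → f (suc i ∷ v))

sumℤ-wordsLen : ∀ m k (f : Word → ℤ) →
  sumℤ (map f (wordsLen m (suc k))) ≡ ∑[ i < m ] sumℤ (map (λ v → f (suc i ∷ v)) (wordsLen m k))
sumℤ-wordsLen m k f = begin
  sumℤ (map f (concatMap (λ a → map (a ∷_) (wordsLen m k)) (map suc (upTo m))))
    ≡⟨ sumℤ-concatMap f _ (map suc (upTo m)) ⟩
  sumℤ (map (λ a → sumℤ (map f (map (a ∷_) (wordsLen m k)))) (map suc (upTo m)))
    ≡⟨ cong sumℤ (sym (List.map-∘ (upTo m))) ⟩
  sumℤ (map (λ i → sumℤ (map f (map (suc i ∷_) (wordsLen m k)))) (upTo m))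
    ≡⟨ sumℤ-map-upTo m _ ⟩
  ∑[ i < m ] sumℤ (map f (map (suc i ∷_) (wordsLen m k)))
    ≡⟨ ∑<-cong m (λ i _ → cong sumℤ (sym (List.map-∘ (wordsLen m k)))) ⟩
  ∑[ i < m ] sumℤ (map (λ v → f (suc i ∷ v)) (wordsLen m k)) ∎

∑W-byLength : ∀ m n (f : Word → ℤ) → ∑W m n f ≡ ∑[ k < suc n ] sumℤ (map f (wordsLen m k))
∑W-byLength m zero    f = sym (trans (ℤ.+-identityʳ _) (ℤ.+-identityʳ _))
∑W-byLength m (suc n) f = begin
  f [] + ∑[ i < m ] ∑W m n (λ v → f (suc i ∷ v))
    ≡⟨ cong (f [] +_) (∑<-cong m (λ i _ → ∑W-byLength m n (λ v → f (suc i ∷ v)))) ⟩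
  f [] + ∑[ i < m ] ∑[ k < suc n ] sumℤ (map (λ v → f (suc i ∷ v)) (wordsLen m k))
    ≡⟨ cong (f [] +_) (∑<-swap m (suc n) (λ i k → sumℤ (map (λ v → f (suc i ∷ v)) (wordsLen m k)))) ⟩
  f [] + ∑[ k < suc n ] ∑[ i < m ] sumℤ (map (λ v → f (suc i ∷ v)) (wordsLen m k))
    ≡⟨ cong₂ _+_ (sym (ℤ.+-identityʳ (f [])))
                 (∑<-cong (suc n) {g = λ k → sumℤ (map f (wordsLen m (suc k)))}
                          (λ k _ → sym (sumℤ-wordsLen m k f))) ⟩
  f [] + 0ℤ + ∑[ k < suc n ] sumℤ (map f (wordsLen m (suc k))) ∎

sumℤ-wordsUpTo : ∀ m n (f : Word → ℤ) → sumℤ (map f (wordsUpTo m n)) ≡ ∑W m n f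
sumℤ-wordsUpTo m n f = begin
  sumℤ (map f (concatMap (wordsLen m) (upTo (suc n))))
    ≡⟨ sumℤ-concatMap f (wordsLen m) (upTo (suc n)) ⟩
  sumℤ (map (λ k → sumℤ (map f (wordsLen m k))) (upTo (suc n)))
    ≡⟨ sumℤ-map-upTo (suc n) (λ k → sumℤ (map f (wordsLen m k))) ⟩
  ∑[ k < suc n ] sumℤ (map f (wordsLen m k))
    ≡⟨ ∑W-byLength m n f ⟨
  ∑W m n f ∎

∑W-cong : ∀ m n {f g : Word → ℤ} → (∀ v → Composition v → f v ≡ g v) → ∑W m n f ≡ ∑W m n g
∑W-cong m zero    eq = eq [] []
∑W-cong m (suc n) eq =
  cong₂ _+_ (eq [] []) (∑<-cong m (λ i _ → ∑W-cong m n (λ v cv → eq (suc i ∷ v) (s≤s z≤n ∷ cv))))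

∑W-vanish : ∀ m n {f : Word → ℤ} → (∀ v → f v ≡ 0ℤ) → ∑W m n f ≡ 0ℤ
∑W-vanish m zero    eq = eq []
∑W-vanish m (suc n) eq = cong₂ _+_ (eq []) (∑<-vanish m (λ i _ → ∑W-vanish m n (λ v → eq (suc i ∷ v))))

∑W-- : ∀ m n (f g : Word → ℤ) → ∑W m n (λ v → f v - g v) ≡ ∑W m n f - ∑W m n g
∑W-- m zero    f g = refl
∑W-- m (suc n) f g = begin
  f [] - g [] + ∑[ i < m ] ∑W m n (λ v → f (suc i ∷ v) - g (suc i ∷ v))
    ≡⟨ cong (f [] - g [] +_) (trans (∑<-cong m (λ i _ → ∑W-- m n _ _)) (∑<-- m _ _)) ⟩
  f [] - g [] + (∑[ i < m ] ∑W m n (λ v → f (suc i ∷ v)) - ∑[ i < m ] ∑W m n (λ v → g (suc i ∷ v)))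
    ≡⟨ interchange (f []) (g []) _ _ ⟩
  f [] + ∑[ i < m ] ∑W m n (λ v → f (suc i ∷ v)) - (g [] + ∑[ i < m ] ∑W m n (λ v → g (suc i ∷ v))) ∎
  where
  interchange : ∀ a b c d → a - b + (c - d) ≡ a + c - (b + d)
  interchange = solve-∀

∑W-distribʳ-- : ∀ m n (c d G : Word → ℤ) →
  ∑W m n (λ v → (c v - d v) * G v) ≡ ∑W m n (λ v → c v * G v) - ∑W m n (λ v → d v * G v)
∑W-distribʳ-- m n c d G = trans (∑W-cong m n (λ v _ → [x-y]*z≡x*z-y*z (c v) (d v) (G v)))
                                (∑W-- m n (λ v → c v * G v) (λ v → d v * G v))
  where
  [x-y]*z≡x*z-y*z : ∀ x y z → (x - y) * z ≡ x * z - y * z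
  [x-y]*z≡x*z-y*z = solve-∀

∑W-*ˡ : ∀ m n c (f : Word → ℤ) → ∑W m n (λ v → c * f v) ≡ c * ∑W m n f
∑W-*ˡ m zero    c f = refl
∑W-*ˡ m (suc n) c f =
  trans (cong (c * f [] +_) (trans (∑<-cong m (λ i _ → ∑W-*ˡ m n c _)) (∑<-*ˡ c m _)))
        (sym (ℤ.*-distribˡ-+ c (f []) _))

∑W-∑< : ∀ m n k (f : ℕ → Word → ℤ) → ∑W m n (λ v → ∑[ e < k ] f e v) ≡ ∑[ e < k ] ∑W m n (f e)
∑W-∑< m zero    k f = refl
∑W-∑< m (suc n) k f = begin
  ∑[ e < k ] f e [] + ∑[ i < m ] ∑W m n (λ v → ∑[ e < k ] f e (suc i ∷ v))
    ≡⟨ cong (∑[ e < k ] f e [] +_) (∑<-cong m (λ i _ → ∑W-∑< m n k (λ e v → f e (suc i ∷ v)))) ⟩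
  ∑[ e < k ] f e [] + ∑[ i < m ] ∑[ e < k ] ∑W m n (λ v → f e (suc i ∷ v))
    ≡⟨ cong (∑[ e < k ] f e [] +_) (∑<-swap m k _) ⟩
  ∑[ e < k ] f e [] + ∑[ e < k ] ∑[ i < m ] ∑W m n (λ v → f e (suc i ∷ v))
    ≡⟨ sym (∑<-+ k _ _) ⟩
  ∑[ e < k ] (f e [] + ∑[ i < m ] ∑W m n (λ v → f e (suc i ∷ v))) ∎

Bounded : ℕ → Word → Set
Bounded m = All (_≤ m)

∑W-single : ∀ m n (f : Word → ℤ) x → Composition x → Bounded m x → length x ≤ n →
            (∀ v → v ≢ x → f v ≡ 0ℤ) → ∑W m n f ≡ f x
∑W-single m zero    f [] _ _ _ off = refl
∑W-single m (suc n) f [] _ _ _ off = begin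
  f [] + ∑[ i < m ] ∑W m n (λ v → f (suc i ∷ v))
    ≡⟨ cong (f [] +_) (∑<-vanish m (λ i _ → ∑W-vanish m n (λ v → off _ λ ()))) ⟩
  f [] + 0ℤ  ≡⟨ ℤ.+-identityʳ _ ⟩
  f []       ∎
∑W-single m (suc n) f (suc a ∷ x) (_ ∷ cx) (a<m ∷ bx) (s≤s ∣x∣≤n) off = begin
  f [] + ∑[ i < m ] ∑W m n (λ v → f (suc i ∷ v))
    ≡⟨ cong (_+ ∑[ i < m ] ∑W m n (λ v → f (suc i ∷ v))) (off [] λ ()) ⟩
  0ℤ + ∑[ i < m ] ∑W m n (λ v → f (suc i ∷ v))
    ≡⟨ ℤ.+-identityˡ _ ⟩
  ∑[ i < m ] ∑W m n (λ v → f (suc i ∷ v))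
    ≡⟨ ∑<-single m _ a a<m
         (λ i i≢a → ∑W-vanish m n (λ v → off _ (i≢a ∘ ℕ.suc-injective ∘ List.∷-injectiveˡ))) ⟩
  ∑W m n (λ v → f (suc a ∷ v))
    ≡⟨ ∑W-single m n (λ v → f (suc a ∷ v)) x cx bx ∣x∣≤n (λ v v≢x → off _ (v≢x ∘ List.∷-injectiveʳ)) ⟩
  f (suc a ∷ x) ∎

∑W-lift : ∀ m n (f : Word → ℤ) → (∀ v → n < length v → f v ≡ 0ℤ) → ∑W m (suc n) f ≡ ∑W m n f
∑W-lift m zero    f long =
  trans (cong (f [] +_) (∑<-vanish m (λ i _ → long _ (s≤s z≤n)))) (ℤ.+-identityʳ _)
∑W-lift m (suc n) f long =
  cong (f [] +_) (∑<-cong m (λ i _ → ∑W-lift m n _ (λ v n<∣v∣ → long _ (s≤s n<∣v∣))))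

∑≤ : Word → (Word → ℤ) → ℤ
∑≤ []      f = f []
∑≤ (b ∷ w) f = ∑[ e < suc b ] ∑≤ w (λ η → f (e ∷ η))

∑≤-cong : ∀ w {f g : Word → ℤ} → (∀ η → Pointwise _≤_ η w → f η ≡ g η) → ∑≤ w f ≡ ∑≤ w g
∑≤-cong []      eq = eq [] []
∑≤-cong (b ∷ w) eq = ∑<-cong (suc b) (λ e e≤b → ∑≤-cong w (λ η η≤w → eq (e ∷ η) (ℕ.≤-pred e≤b ∷ η≤w)))

∑≤-vanish : ∀ w {f : Word → ℤ} → (∀ η → Pointwise _≤_ η w → f η ≡ 0ℤ) → ∑≤ w f ≡ 0ℤ
∑≤-vanish []      eq = eq [] []
∑≤-vanish (b ∷ w) eq =
  ∑<-vanish (suc b) (λ e e≤b → ∑≤-vanish w (λ η η≤w → eq (e ∷ η) (ℕ.≤-pred e≤b ∷ η≤w)))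

∑≤-+ : ∀ w (f g : Word → ℤ) → ∑≤ w (λ η → f η + g η) ≡ ∑≤ w f + ∑≤ w g
∑≤-+ []      f g = refl
∑≤-+ (b ∷ w) f g = trans (∑<-cong (suc b) (λ e _ → ∑≤-+ w (λ η → f (e ∷ η)) (λ η → g (e ∷ η))))
                         (∑<-+ (suc b) (λ e → ∑≤ w (λ η → f (e ∷ η))) (λ e → ∑≤ w (λ η → g (e ∷ η))))

∑≤-*ˡ : ∀ w c (f : Word → ℤ) → ∑≤ w (λ η → c * f η) ≡ c * ∑≤ w f
∑≤-*ˡ []      c f = refl
∑≤-*ˡ (b ∷ w) c f = trans (∑<-cong (suc b) (λ e _ → ∑≤-*ˡ w c (λ η → f (e ∷ η))))
                          (∑<-*ˡ c (suc b) (λ e → ∑≤ w (λ η → f (e ∷ η))))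

∑≤-single : ∀ w (f : Word → ℤ) x → Pointwise _≤_ x w → (∀ η → η ≢ x → f η ≡ 0ℤ) → ∑≤ w f ≡ f x
∑≤-single []      f [] []          off = refl
∑≤-single (b ∷ w) f (e ∷ x) (e≤b ∷ x≤w) off = begin
  ∑[ i < suc b ] ∑≤ w (λ η → f (i ∷ η))
    ≡⟨ ∑<-single (suc b) (λ i → ∑≤ w (λ η → f (i ∷ η))) e (s≤s e≤b)
         (λ i i≢e → ∑≤-vanish w (λ η _ → off _ (i≢e ∘ List.∷-injectiveˡ))) ⟩
  ∑≤ w (λ η → f (e ∷ η))
    ≡⟨ ∑≤-single w (λ η → f (e ∷ η)) x x≤w (λ η η≢x → off _ (η≢x ∘ List.∷-injectiveʳ)) ⟩
  f (e ∷ x) ∎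

𝟙-∈-∷ : ∀ {x : Word} {L} η → x ∉ L → 𝟙 (η ∈? x ∷ L) ≡ 𝟙 (η ≟w x) + 𝟙 (η ∈? L)
𝟙-∈-∷ {x} {L} η x∉L = split (η ≟w x)
  where
  split : Dec (η ≡ x) → 𝟙 (η ∈? x ∷ L) ≡ 𝟙 (η ≟w x) + 𝟙 (η ∈? L)
  split (yes refl) = trans (𝟙-yes (η ∈? x ∷ L) (here refl))
                           (sym (cong₂ _+_ (𝟙-yes (η ≟w x) refl) (𝟙-no (η ∈? L) x∉L)))
  split (no η≢x)   = trans (𝟙-⇔ (λ { (here η≡x) → contradiction η≡x η≢x ; (there η∈L) → η∈L }) there
                                 (η ∈? x ∷ L) (η ∈? L))
                           (sym (trans (cong (_+ 𝟙 (η ∈? L)) (𝟙-no (η ≟w x) η≢x)) (ℤ.+-identityˡ _)))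

sumℤ-unique : ∀ w (L : List Word) → Unique L → All (λ η → Pointwise _≤_ η w) L → (g : Word → ℤ) →
              sumℤ (map g L) ≡ ∑≤ w (λ η → 𝟙 (η ∈? L) * g η)
sumℤ-unique w []      _                _            g =
  sym (∑≤-vanish w (λ η _ → 𝟙-*-no (η ∈? []) (λ ()) (g η)))
sumℤ-unique w (x ∷ L) (x≢L ∷ unique) (x≤w ∷ L≤w) g = sym (begin
  ∑≤ w (λ η → 𝟙 (η ∈? x ∷ L) * g η)
    ≡⟨ ∑≤-cong w (λ η _ → trans (cong (_* g η) (𝟙-∈-∷ η (All¬⇒¬Any x≢L)))
                                (ℤ.*-distribʳ-+ (g η) (𝟙 (η ≟w x)) (𝟙 (η ∈? L)))) ⟩
  ∑≤ w (λ η → 𝟙 (η ≟w x) * g η + 𝟙 (η ∈? L) * g η)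
    ≡⟨ ∑≤-+ w (λ η → 𝟙 (η ≟w x) * g η) (λ η → 𝟙 (η ∈? L) * g η) ⟩
  ∑≤ w (λ η → 𝟙 (η ≟w x) * g η) + ∑≤ w (λ η → 𝟙 (η ∈? L) * g η)
    ≡⟨ cong₂ _+_ (∑≤-single w _ x x≤w (λ η η≢x → 𝟙-*-no (η ≟w x) η≢x (g η)))
                 (sym (sumℤ-unique w L unique L≤w g)) ⟩
  𝟙 (x ≟w x) * g x + sumℤ (map g L)
    ≡⟨ cong (_+ sumℤ (map g L)) (𝟙-*-yes (x ≟w x) refl (g x)) ⟩
  g x + sumℤ (map g L) ∎)

≼-refl : ∀ w → w ≼ w
≼-refl []      = []≼
≼-refl (b ∷ w) = keep ℕ.≤-refl (≼-refl w)

∷≼⇒≼ : ∀ {a v w} → a ∷ v ≼ w → v ≼ w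
∷≼⇒≼ (keep _ v≼w) = skip v≼w
∷≼⇒≼ (skip av≼w)  = skip (∷≼⇒≼ av≼w)

∷≼∷⇒≼ : ∀ {a c v y} → a ≤ c → a ∷ v ≼ c ∷ y → v ≼ y
∷≼∷⇒≼ _ (keep _ v≼y) = v≼y
∷≼∷⇒≼ _ (skip av≼y)  = ∷≼⇒≼ av≼y

∷≼∷⇒∷≼ : ∀ {a c v y} → ¬ a ≤ c → a ∷ v ≼ c ∷ y → a ∷ v ≼ y
∷≼∷⇒∷≼ a≰c (keep a≤c _) = contradiction a≤c a≰c
∷≼∷⇒∷≼ _   (skip av≼y)  = av≼y

≼-length : ∀ {v w} → v ≼ w → length v ≤ length w
≼-length []≼          = z≤n
≼-length (keep _ v≼w) = s≤s (≼-length v≼w)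
≼-length (skip v≼w)   = ℕ.m≤n⇒m≤1+n (≼-length v≼w)

deleteZeros-≼ : ∀ {η w} → Pointwise _≤_ η w → deleteZeros η ≼ w
deleteZeros-≼ []                     = []≼
deleteZeros-≼ {zero ∷ η}  (_ ∷ η≤w)   = skip (deleteZeros-≼ η≤w)
deleteZeros-≼ {suc e ∷ η} (e≤b ∷ η≤w) = keep e≤b (deleteZeros-≼ η≤w)

size : Word → ℕ
size []      = 0
size (b ∷ w) = suc (b ℕ.+ size w)

size≡length+sum : ∀ w → size w ≡ length w ℕ.+ sum w
size≡length+sum []      = refl
size≡length+sum (b ∷ w) = cong suc (begin
  b ℕ.+ size w                  ≡⟨ cong (b ℕ.+_) (size≡length+sum w) ⟩
  b ℕ.+ (length w ℕ.+ sum w)    ≡⟨ ℕ+.x∙yz≈y∙xz b (length w) (sum w) ⟩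
  length w ℕ.+ (b ℕ.+ sum w)    ∎)

≼-size : ∀ {v w} → v ≼ w → size v ≤ size w
≼-size []≼                    = z≤n
≼-size (keep a≤b v≼w)         = s≤s (ℕ.+-mono-≤ a≤b (≼-size v≼w))
≼-size {w = b ∷ w} (skip v≼w) = ℕ.m≤n⇒m≤1+n (ℕ.≤-trans (≼-size v≼w) (ℕ.m≤n+m (size w) b))

≺-size : ∀ {v w} → v ≼ w → v ≢ w → size v < size w
≺-size {[]}    {[]}    []≼  v≢w = contradiction refl v≢w
≺-size {[]}    {_ ∷ _} []≼  _   = s≤s z≤n
≺-size {a ∷ v} {b ∷ w} (keep a≤b v≼w) av≢bw with a ≟ b | v ≟w w
... | yes refl | yes refl = contradiction refl av≢bw
... | yes refl | no v≢w   = s≤s (ℕ.+-monoʳ-< a (≺-size v≼w v≢w))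
... | no a≢b   | _        = s≤s (ℕ.+-mono-<-≤ (ℕ.≤∧≢⇒< a≤b a≢b) (≼-size v≼w))
≺-size {w = b ∷ w} (skip v≼w) _ = s≤s (ℕ.≤-trans (≼-size v≼w) (ℕ.m≤n+m (size w) b))

≼-antisym : ∀ {v w} → v ≼ w → w ≼ v → v ≡ w
≼-antisym {v} {w} v≼w w≼v with v ≟w w
... | yes v≡w = v≡w
... | no v≢w  = contradiction (≼-size w≼v) (ℕ.<⇒≱ (≺-size v≼w v≢w))

-- Möbius inversion

maxL-bounded : ∀ w → Bounded (maxL w) w
maxL-bounded []      = []
maxL-bounded (b ∷ w) =
  ℕ.m≤m⊔n b (maxL w) ∷ All.map (λ a≤ → ℕ.≤-trans a≤ (ℕ.m≤n⊔m b (maxL w))) (maxL-bounded w)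

sumℤ-interval : ∀ u w (g : Word → ℤ) →
  sumℤ (map g (interval u w)) ≡ ∑W (maxL w) (length w) (λ v → 𝟙 ((u ≼? v) ×-dec (v ≼? w)) * g v)
sumℤ-interval u w g = trans (sumℤ-filter (λ v → (u ≼? v) ×-dec (v ≼? w)) g _)
                            (sumℤ-wordsUpTo (maxL w) (length w) (λ v → 𝟙 ((u ≼? v) ×-dec (v ≼? w)) * g v))

module _ (u : Word) (F : Word → ℤ) (F-vanish : ∀ v → ¬ u ≼ v → F v ≡ 0ℤ)
         (F-lowerSum : ∀ w → Composition w →
                       ∑W (maxL w) (length w) (λ v → 𝟙 (v ≼? w) * F v) ≡ 𝟙 (u ≟w w)) where

  private
    ∑W-≟ : ∀ w → Composition w → ∑W (maxL w) (length w) (λ v → 𝟙 (v ≟w w) * F v) ≡ F w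
    ∑W-≟ w cw = trans (∑W-single (maxL w) (length w) _ w cw (maxL-bounded w) ℕ.≤-refl
                                  (λ v v≢w → 𝟙-*-no (v ≟w w) v≢w (F v)))
                      (𝟙-*-yes (w ≟w w) refl (F w))

    F-self : Composition u → F u ≡ 1ℤ
    F-self cu = begin
      F u  ≡⟨ 𝟙-*-yes (u ≼? u) (≼-refl u) (F u) ⟨
      𝟙 (u ≼? u) * F u
        ≡⟨ ∑W-single (maxL u) (length u) _ u cu (maxL-bounded u) ℕ.≤-refl below ⟨
      ∑W (maxL u) (length u) (λ v → 𝟙 (v ≼? u) * F v)  ≡⟨ F-lowerSum u cu ⟩
      𝟙 (u ≟w u)  ≡⟨ 𝟙-yes (u ≟w u) refl ⟩
      1ℤ  ∎
      where
      below : ∀ v → v ≢ u → 𝟙 (v ≼? u) * F v ≡ 0ℤ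
      below v v≢u with v ≼? u
      ... | yes v≼u = trans (ℤ.*-identityˡ (F v)) (F-vanish v (v≢u ∘ ≼-antisym v≼u))
      ... | no _    = refl

    mobiusF-unique : ∀ f w → Composition w → u ≼ w → size w < f → mobiusF f u w ≡ F w
    mobiusF-unique (suc f) w cw u≼w w<f with u ≟w w
    ... | yes refl = sym (F-self cw)
    ... | no u≢w   = begin
      - sumℤ (map (mobiusF f u) (filter (λ v → ¬? (v ≟w w)) (interval u w)))
        ≡⟨ cong -_ (sumℤ-filter (λ v → ¬? (v ≟w w)) (mobiusF f u) (interval u w)) ⟩
      - sumℤ (map (λ v → 𝟙 (¬? (v ≟w w)) * mobiusF f u v) (interval u w))
        ≡⟨ cong -_ (sumℤ-interval u w _) ⟩
      - ∑W M n (λ v → 𝟙 ((u ≼? v) ×-dec (v ≼? w)) * (𝟙 (¬? (v ≟w w)) * mobiusF f u v))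
        ≡⟨ cong -_ (∑W-cong M n (λ v cv → strictlyBelow v cv (u ≼? v) (v ≼? w) (v ≟w w))) ⟩
      - ∑W M n (λ v → 𝟙 (v ≼? w) * F v - 𝟙 (v ≟w w) * F v)
        ≡⟨ cong -_ (∑W-- M n (λ v → 𝟙 (v ≼? w) * F v) (λ v → 𝟙 (v ≟w w) * F v)) ⟩
      - (∑W M n (λ v → 𝟙 (v ≼? w) * F v) - ∑W M n (λ v → 𝟙 (v ≟w w) * F v))
        ≡⟨ cong₂ (λ a b → - (a - b)) (trans (F-lowerSum w cw) (𝟙-no (u ≟w w) u≢w)) (∑W-≟ w cw) ⟩
      - (0ℤ - F w)
        ≡⟨ cong -_ (ℤ.+-identityˡ (- F w)) ⟩
      - - F w
        ≡⟨ ℤ.neg-involutive (F w) ⟩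
      F w ∎
      where
      M = maxL w
      n = length w
      strictlyBelow : ∀ v → Composition v →
        (u≼v? : Dec (u ≼ v)) (v≼w? : Dec (v ≼ w)) (v≡w? : Dec (v ≡ w)) →
        𝟙 (u≼v? ×-dec v≼w?) * (𝟙 (¬? v≡w?) * mobiusF f u v) ≡ 𝟙 v≼w? * F v - 𝟙 v≡w? * F v
      strictlyBelow v cv (yes _)   (yes _)   (yes _)   = sym (ℤ.+-inverseʳ (1ℤ * F v))
      strictlyBelow v cv (yes u≼v) (yes v≼w) (no v≢w)  = begin
        1ℤ * (1ℤ * mobiusF f u v)  ≡⟨ ℤ.*-identityˡ _ ⟩
        1ℤ * mobiusF f u v         ≡⟨ cong (1ℤ *_) (mobiusF-unique f v cv u≼v v<f) ⟩
        1ℤ * F v                   ≡⟨ ℤ.+-identityʳ _ ⟨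
        1ℤ * F v - 0ℤ * F v        ∎
        where v<f = ℕ.<-≤-trans (≺-size v≼w v≢w) (ℕ.≤-pred w<f)
      strictlyBelow v cv (yes _)   (no v⋠w)  (yes refl) = contradiction (≼-refl v) v⋠w
      strictlyBelow v cv (yes _)   (no _)    (no _)    = refl
      strictlyBelow v cv (no u⋠v)  v≼w?      v≡w?      rewrite F-vanish v u⋠v =
        sym (cong₂ _-_ (ℤ.*-zeroʳ (𝟙 v≼w?)) (ℤ.*-zeroʳ (𝟙 v≡w?)))

  μ-unique : ∀ w → Composition w → u ≼ w → μ u w ≡ F w
  μ-unique w cw u≼w = mobiusF-unique _ w cw u≼w (s≤s (ℕ.≤-reflexive (size≡length+sum w)))

-- Normality as a local condition

-- The letter e of η under the letter b of w, p being the letter of w before b (0 at the start).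
-- A 1 preceded by a 1 is inside a run of 1s, and b ≥ 2 with p ≢ b starts a run of b's, so
-- these are exactly the positions that the run conditions of normality put into the support.
LocallyNormal : ℕ → ℕ → ℕ → Set
LocallyNormal p b e = (e ≡ b ⊎ e ≡ b ∸ 1 ⊎ e ≡ 0) × (b ≡ 1 → p ≡ 1 → e ≢ 0) × (2 ≤ b → p ≢ b → e ≢ 0)

locallyNormal? : ∀ p b e → Dec (LocallyNormal p b e)
locallyNormal? p b e = ((e ≟ b) ⊎-dec (e ≟ b ∸ 1) ⊎-dec (e ≟ 0))
                 ×-dec ((b ≟ 1) →-dec (p ≟ 1) →-dec ¬? (e ≟ 0))
                 ×-dec ((2 ≤? b) →-dec ¬? (p ≟ b) →-dec ¬? (e ≟ 0))

NormalFrom : ℕ → Word → Word → Set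
NormalFrom p []      []      = ⊤
NormalFrom p []      (_ ∷ _) = ⊥
NormalFrom p (_ ∷ _) []      = ⊥
NormalFrom p (b ∷ w) (e ∷ η) = LocallyNormal p b e × NormalFrom b w η

normalFrom? : ∀ p w η → Dec (NormalFrom p w η)
normalFrom? p []      []      = yes tt
normalFrom? p []      (_ ∷ _) = no λ ()
normalFrom? p (_ ∷ _) []      = no λ ()
normalFrom? p (b ∷ w) (e ∷ η) = locallyNormal? p b e ×-dec normalFrom? b w η

-- at (p ∷ w) i is the letter of w before position i, and p for i = 1.
NormalAt : ℕ → Word → Word → Set
NormalAt p w η = ∀ i → 1 ≤ i → i ≤ length w → LocallyNormal (at (p ∷ w) i) (at w i) (at η i)

NormalFrom⇒NormalAt : ∀ p w η → NormalFrom p w η → NormalAt p w η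
NormalFrom⇒NormalAt p (b ∷ w) (e ∷ η) (first , _)   (suc zero)    _ _         = first
NormalFrom⇒NormalAt p (b ∷ w) (e ∷ η) (_ , further) (suc (suc j)) _ (s≤s j<) =
  NormalFrom⇒NormalAt b w η further (suc j) (s≤s z≤n) j<

NormalAt⇒NormalFrom : ∀ p w η → length η ≡ length w → NormalAt p w η → NormalFrom p w η
NormalAt⇒NormalFrom p []      []      _   _      = tt
NormalAt⇒NormalFrom p (b ∷ w) (e ∷ η) ∣η∣≡∣w∣ normal =
  normal 1 ℕ.≤-refl (s≤s z≤n) ,
  NormalAt⇒NormalFrom b w η (ℕ.suc-injective ∣η∣≡∣w∣)
    (λ { (suc j) _ j< → normal (suc (suc j)) (s≤s z≤n) (s≤s j<) })

Constant : Word → ℕ → ℕ → ℕ → Set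
Constant w k r t = ∀ x → r ≤ x → x ≤ t → at w x ≡ k

LeftMaximal : Word → ℕ → ℕ → Set
LeftMaximal w k r = r ≡ 1 ⊎ at w (r ∸ 1) ≢ k

RightMaximal : Word → ℕ → ℕ → Set
RightMaximal w k t = t ≡ length w ⊎ at w (suc t) ≢ k

Constant-single : ∀ w {k i} → at w i ≡ k → Constant w k i i
Constant-single w {k} wi≡k x i≤x x≤i = subst (λ y → at w y ≡ k) (ℕ.≤-antisym i≤x x≤i) wi≡k

Constant-++ : ∀ w {k r i t} → Constant w k r i → Constant w k (suc i) t → Constant w k r t
Constant-++ w {i = i} left right x r≤x x≤t with x ≤? i
... | yes x≤i = left x r≤x x≤i
... | no x≰i  = right x (ℕ.≰⇒> x≰i) x≤t

runEnd : ∀ w k i → i ≤ length w → at w i ≡ k →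
         ∃[ t ] i ≤ t × t ≤ length w × Constant w k i t × RightMaximal w k t
runEnd w k i i≤∣w∣ = scan (length w ∸ i) i (ℕ.m∸n+n≡m i≤∣w∣)
  where
  scan : ∀ d i → d ℕ.+ i ≡ length w → at w i ≡ k →
         ∃[ t ] i ≤ t × t ≤ length w × Constant w k i t × RightMaximal w k t
  scan zero    i refl wi≡k = i , ℕ.≤-refl , ℕ.≤-refl , Constant-single w wi≡k , inj₁ refl
  scan (suc d) i d+i≡∣w∣ wi≡k with at w (suc i) ≟ k
  ... | no next≢k = i , ℕ.≤-refl , ℕ.≤-trans (ℕ.m≤n+m i (suc d)) (ℕ.≤-reflexive d+i≡∣w∣) ,
                    Constant-single w wi≡k , inj₂ next≢k
  ... | yes next≡k with scan d (suc i) (trans (ℕ.+-suc d i) d+i≡∣w∣) next≡k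
  ...   | t , i<t , t≤∣w∣ , constant , maximal =
          t , ℕ.≤-trans (ℕ.n≤1+n i) i<t , t≤∣w∣ , Constant-++ w (Constant-single w wi≡k) constant , maximal

runStart : ∀ w k j → at w (suc j) ≡ k →
           ∃[ r ] 1 ≤ r × r ≤ suc j × Constant w k r (suc j) × LeftMaximal w k r
runStart w k zero    w1≡k = 1 , ℕ.≤-refl , ℕ.≤-refl , Constant-single w w1≡k , inj₁ refl
runStart w k (suc j) wj≡k with at w (suc j) ≟ k
... | no prev≢k = suc (suc j) , s≤s z≤n , ℕ.≤-refl , Constant-single w wj≡k , inj₂ prev≢k
... | yes prev≡k with runStart w k j prev≡k
...   | r , 1≤r , r≤j , constant , maximal =
        r , 1≤r , ℕ.m≤n⇒m≤1+n r≤j , Constant-++ w constant (Constant-single w wj≡k) , maximal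

LeftMaximal⇒pred≢ : ∀ {w k r} → 1 ≤ r → 1 ≤ k → LeftMaximal w k r → at (0 ∷ w) r ≢ k
LeftMaximal⇒pred≢ {r = suc zero}    _ 1≤k _             0≡k = contradiction (subst (1 ≤_) (sym 0≡k) 1≤k) λ ()
LeftMaximal⇒pred≢ {r = suc (suc j)} _ _   (inj₂ pred≢k) = pred≢k

pred≢⇒LeftMaximal : ∀ {w k r} → 1 ≤ r → at (0 ∷ w) r ≢ k → LeftMaximal w k r
pred≢⇒LeftMaximal {r = suc zero}    _ _      = inj₁ refl
pred≢⇒LeftMaximal {r = suc (suc j)} _ pred≢k = inj₂ pred≢k

LetterCondition : Word → Word → Set
LetterCondition w η =
  ∀ i → 1 ≤ i → i ≤ length w → at η i ≡ at w i ⊎ at η i ≡ at w i ∸ 1 ⊎ at η i ≡ 0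

RunCondition : Word → Word → Set
RunCondition w η = ∀ k r t → 1 ≤ k → IsRun w k r t →
  (k ≡ 1 → ∀ i → r < i → i ≤ t → InSupp η i) × (2 ≤ k → InSupp η r)

NormalAt⇒RunCondition : ∀ w η → NormalAt 0 w η → RunCondition w η
NormalAt⇒RunCondition w η normal k r t 1≤k (1≤r , r≤t , t≤∣w∣ , constant , leftMax , _) =
  insideOnes , atStart
  where
  insideOnes : k ≡ 1 → ∀ i → r < i → i ≤ t → InSupp η i
  insideOnes _    (suc zero)    (s≤s r≤0)   _   = contradiction (ℕ.≤-trans 1≤r r≤0) λ ()
  insideOnes refl (suc (suc j)) (s≤s r≤j+1) i≤t =
    proj₁ (proj₂ (normal (suc (suc j)) (s≤s z≤n) (ℕ.≤-trans i≤t t≤∣w∣)))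
      (constant _ (ℕ.m≤n⇒m≤1+n r≤j+1) i≤t)
      (constant _ r≤j+1 (ℕ.≤-trans (ℕ.n≤1+n _) i≤t))
  atStart : 2 ≤ k → InSupp η r
  atStart 2≤k = proj₂ (proj₂ (normal r 1≤r (ℕ.≤-trans r≤t t≤∣w∣)))
    (subst (2 ≤_) (sym wr≡k) 2≤k)
    (λ pred≡wr → LeftMaximal⇒pred≢ 1≤r 1≤k leftMax (trans pred≡wr wr≡k))
    where wr≡k = constant r ℕ.≤-refl r≤t

conditions⇒NormalAt : ∀ w η → LetterCondition w η → RunCondition w η → NormalAt 0 w η
conditions⇒NormalAt w η letters runs i 1≤i i≤∣w∣ = letters i 1≤i i≤∣w∣ , insideOnes i i≤∣w∣ , atStart
  where
  insideOnes : ∀ i → i ≤ length w → at w i ≡ 1 → at (0 ∷ w) i ≡ 1 → at η i ≢ 0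
  insideOnes (suc (suc j)) i≤∣w∣ wi≡1 wj≡1
    with runStart w 1 j wj≡1 | runEnd w 1 (suc (suc j)) i≤∣w∣ wi≡1
  ... | r , 1≤r , r≤j+1 , left , leftMax | t , i≤t , t≤∣w∣ , right , rightMax =
    proj₁ (runs 1 r t ℕ.≤-refl (1≤r , r≤t , t≤∣w∣ , Constant-++ w left right , leftMax , rightMax))
      refl (suc (suc j)) (s≤s r≤j+1) i≤t
    where r≤t = ℕ.≤-trans r≤j+1 (ℕ.≤-trans (ℕ.n≤1+n _) i≤t)
  atStart : 2 ≤ at w i → at (0 ∷ w) i ≢ at w i → at η i ≢ 0
  atStart 2≤wi pred≢wi with runEnd w (at w i) i i≤∣w∣ refl
  ... | t , i≤t , t≤∣w∣ , constant , rightMax =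
    proj₂ (runs (at w i) i t (ℕ.≤-trans (s≤s z≤n) 2≤wi)
                (1≤i , i≤t , t≤∣w∣ , constant , pred≢⇒LeftMaximal 1≤i pred≢wi , rightMax))
          2≤wi

normalEmbedding⇔ : ∀ u w η →
  IsNormalEmbedding u w η ⇔ (deleteZeros η ≡ u × Pointwise _≤_ η w × NormalFrom 0 w η)
normalEmbedding⇔ u w η = mk⇔
  (λ ((η↾≡u , η≤w) , letters , runs) →
     η↾≡u , η≤w ,
     NormalAt⇒NormalFrom 0 w η (Pointwise.Pointwise-length η≤w) (conditions⇒NormalAt w η letters runs))
  (λ (η↾≡u , η≤w , normal) →
     (η↾≡u , η≤w) ,
     (λ i 1≤i i≤∣w∣ → proj₁ (NormalFrom⇒NormalAt 0 w η normal i 1≤i i≤∣w∣)) ,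
     NormalAt⇒RunCondition w η (NormalFrom⇒NormalAt 0 w η normal))

-- Signed counts of normal embeddings

normalSum : ℕ → Word → Word → ℤ
normalSum p u v = ∑≤ v (λ η → 𝟙 (u ≟w deleteZeros η) * (𝟙 (normalFrom? p v η) * sign (defect η v)))

sumℤ-normalEmbeddings : ∀ u w (L : List Word) → Unique L →
  (∀ η → (η ∈ L) ⇔ IsNormalEmbedding u w η) →
  sumℤ (map (λ η → sign (defect η w)) L) ≡ normalSum 0 u w
sumℤ-normalEmbeddings u w L unique L⇔normal = begin
  sumℤ (map (λ η → sign (defect η w)) L)
    ≡⟨ sumℤ-unique w L unique (All.tabulate (λ {η} η∈L → proj₂ (proj₁ (to η η∈L)))) _ ⟩
  ∑≤ w (λ η → 𝟙 (η ∈? L) * sign (defect η w))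
    ≡⟨ ∑≤-cong w (λ η η≤w → cong (_* sign (defect η w)) (indicator η η≤w)) ⟩
  ∑≤ w (λ η → 𝟙 (u ≟w deleteZeros η) * 𝟙 (normalFrom? 0 w η) * sign (defect η w))
    ≡⟨ ∑≤-cong w (λ η _ → ℤ.*-assoc (𝟙 (u ≟w deleteZeros η)) (𝟙 (normalFrom? 0 w η)) _) ⟩
  normalSum 0 u w ∎
  where
  to : ∀ η → η ∈ L → IsNormalEmbedding u w η
  to η = Equivalence.to (L⇔normal η)
  from : ∀ η → IsNormalEmbedding u w η → η ∈ L
  from η = Equivalence.from (L⇔normal η)
  indicator : ∀ η → Pointwise _≤_ η w → 𝟙 (η ∈? L) ≡ 𝟙 (u ≟w deleteZeros η) * 𝟙 (normalFrom? 0 w η)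
  indicator η η≤w = begin
    𝟙 (η ∈? L)
      ≡⟨ 𝟙-⇔ (λ η∈L → let (η↾≡u , _ , normal) = Equivalence.to (normalEmbedding⇔ u w η) (to η η∈L)
                       in sym η↾≡u , normal)
             (λ (u≡η↾ , normal) →
                from η (Equivalence.from (normalEmbedding⇔ u w η) (sym u≡η↾ , η≤w , normal)))
             (η ∈? L) ((u ≟w deleteZeros η) ×-dec normalFrom? 0 w η) ⟩
    𝟙 ((u ≟w deleteZeros η) ×-dec normalFrom? 0 w η)
      ≡⟨ 𝟙-× (u ≟w deleteZeros η) (normalFrom? 0 w η) ⟩
    𝟙 (u ≟w deleteZeros η) * 𝟙 (normalFrom? 0 w η) ∎

normalSum-[] : ∀ p u → normalSum p u [] ≡ 𝟙 (u ≟w [])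
normalSum-[] p u = ℤ.*-identityʳ (𝟙 (u ≟w []))

normalSum-vanish : ∀ p u v → ¬ u ≼ v → normalSum p u v ≡ 0ℤ
normalSum-vanish p u v u⋠v = ∑≤-vanish v (λ η η≤v →
  𝟙-*-no (u ≟w deleteZeros η) (λ u≡η↾ → u⋠v (subst (_≼ v) (sym u≡η↾) (deleteZeros-≼ η≤v))) _)

-- What remains of the target word u once the letter e of an expansion has been read.
peel : ℕ → Word → (Word → ℤ) → ℤ
peel zero    u       F = F u
peel (suc x) []      F = 0ℤ
peel (suc x) (y ∷ u) F = 𝟙 (y ≟ suc x) * F u

peel-cong : ∀ e u {F G : Word → ℤ} → (∀ u′ → F u′ ≡ G u′) → peel e u F ≡ peel e u G
peel-cong zero    u       eq = eq u
peel-cong (suc x) []      eq = refl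
peel-cong (suc x) (y ∷ u) eq = cong (𝟙 (y ≟ suc x) *_) (eq u)

peel-≟ : ∀ x u w → peel (suc x) u (λ u′ → 𝟙 (u′ ≟w w)) ≡ 𝟙 (u ≟w (suc x ∷ w))
peel-≟ x []      w = refl
peel-≟ x (y ∷ u) w = sym (𝟙-× (y ≟ suc x) (u ≟w w))

∑≤-peel : ∀ w u e (G : Word → ℤ) →
  ∑≤ w (λ η → 𝟙 (u ≟w deleteZeros (e ∷ η)) * G η)
  ≡ peel e u (λ u′ → ∑≤ w (λ η → 𝟙 (u′ ≟w deleteZeros η) * G η))
∑≤-peel w u       zero    G = refl
∑≤-peel w []      (suc x) G = ∑≤-vanish w (λ _ _ → refl)
∑≤-peel w (y ∷ u) (suc x) G = begin
  ∑≤ w (λ η → 𝟙 ((y ∷ u) ≟w (suc x ∷ deleteZeros η)) * G η)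
    ≡⟨ ∑≤-cong w (λ η _ → trans (cong (_* G η) (𝟙-× (y ≟ suc x) (u ≟w deleteZeros η)))
                                (ℤ.*-assoc (𝟙 (y ≟ suc x)) _ (G η))) ⟩
  ∑≤ w (λ η → 𝟙 (y ≟ suc x) * (𝟙 (u ≟w deleteZeros η) * G η))
    ≡⟨ ∑≤-*ˡ w (𝟙 (y ≟ suc x)) (λ η → 𝟙 (u ≟w deleteZeros η) * G η) ⟩
  𝟙 (y ≟ suc x) * ∑≤ w (λ η → 𝟙 (u ≟w deleteZeros η) * G η) ∎

∑W-peel : ∀ m n e u (c : Word → ℤ) (G : Word → Word → ℤ) →
  ∑W m n (λ v → c v * peel e u (λ u′ → G u′ v)) ≡ peel e u (λ u′ → ∑W m n (λ v → c v * G u′ v))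
∑W-peel m n zero    u       c G = refl
∑W-peel m n (suc x) []      c G = ∑W-vanish m n (λ v → ℤ.*-zeroʳ (c v))
∑W-peel m n (suc x) (y ∷ u) c G =
  trans (∑W-cong m n (λ v _ → ℤ*.x∙yz≈y∙xz (c v) (𝟙 (y ≟ suc x)) (G u v)))
        (∑W-*ˡ m n (𝟙 (y ≟ suc x)) (λ v → c v * G u v))

letterSign : ℕ → ℕ → ℤ
letterSign e b with e ≟ b ∸ 1
... | yes _ = -1ℤ
... | no _  = 1ℤ

sign-defect-∷ : ∀ e b η w → sign (defect (e ∷ η) (b ∷ w)) ≡ letterSign e b * sign (defect η w)
sign-defect-∷ e b η w with e ≟ b ∸ 1
... | yes _ = refl
... | no _  = sym (ℤ.*-identityˡ _)

letterWeight : ℕ → ℕ → ℕ → ℤ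
letterWeight p b e = 𝟙 (locallyNormal? p b e) * letterSign e b

normalSum-∷ : ∀ p u b v →
  normalSum p u (b ∷ v) ≡ ∑[ e < suc b ] (letterWeight p b e * peel e u (λ u′ → normalSum b u′ v))
normalSum-∷ p u b v = ∑<-cong (suc b) λ e _ → begin
  ∑≤ v (λ η → 𝟙 (u ≟w deleteZeros (e ∷ η))
              * (𝟙 (normalFrom? p (b ∷ v) (e ∷ η)) * sign (defect (e ∷ η) (b ∷ v))))
    ≡⟨ ∑≤-cong v (λ η _ → factor e η) ⟩
  ∑≤ v (λ η → letterWeight p b e * (𝟙 (u ≟w deleteZeros (e ∷ η)) * rest η))
    ≡⟨ ∑≤-*ˡ v (letterWeight p b e) _ ⟩
  letterWeight p b e * ∑≤ v (λ η → 𝟙 (u ≟w deleteZeros (e ∷ η)) * rest η)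
    ≡⟨ cong (letterWeight p b e *_) (∑≤-peel v u e rest) ⟩
  letterWeight p b e * peel e u (λ u′ → normalSum b u′ v) ∎
  where
  rest : Word → ℤ
  rest η = 𝟙 (normalFrom? b v η) * sign (defect η v)
  factor : ∀ e η →
    𝟙 (u ≟w deleteZeros (e ∷ η)) * (𝟙 (normalFrom? p (b ∷ v) (e ∷ η)) * sign (defect (e ∷ η) (b ∷ v)))
    ≡ letterWeight p b e * (𝟙 (u ≟w deleteZeros (e ∷ η)) * rest η)
  factor e η rewrite 𝟙-× (locallyNormal? p b e) (normalFrom? b v η) | sign-defect-∷ e b η v =
    regroup (𝟙 (u ≟w deleteZeros (e ∷ η))) (𝟙 (locallyNormal? p b e)) (𝟙 (normalFrom? b v η))
            (letterSign e b) (sign (defect η v))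
    where
    regroup : ∀ d l n s r → d * (l * n * (s * r)) ≡ l * s * (d * (n * r))
    regroup = solve-∀

letterSign-≡ : ∀ e b → e ≡ b ∸ 1 → letterSign e b ≡ -1ℤ
letterSign-≡ e b e≡b-1 with e ≟ b ∸ 1
... | yes _     = refl
... | no e≢b-1 = contradiction e≡b-1 e≢b-1

letterSign-≢ : ∀ e b → e ≢ b ∸ 1 → letterSign e b ≡ 1ℤ
letterSign-≢ e b e≢b-1 with e ≟ b ∸ 1
... | yes e≡b-1 = contradiction e≡b-1 e≢b-1
... | no _      = refl

letterWeight-≡ : ∀ p b e → 1 ≤ b → e ≤ b →
  letterWeight p b e ≡ 𝟙 (e ≟ b) - 𝟙 (e ≟ b ∸ 1) + 𝟙 (e ≟ 0) * 𝟙 (p ≟ b)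
letterWeight-≡ zero          1 0 _ _ = refl
letterWeight-≡ 1             1 0 _ _ = refl
letterWeight-≡ (suc (suc p)) 1 0 _ _ = refl
letterWeight-≡ zero          1 1 _ _ = refl
letterWeight-≡ 1             1 1 _ _ = refl
letterWeight-≡ (suc (suc p)) 1 1 _ _ = refl
letterWeight-≡ p 1 (suc (suc _)) _ (s≤s ())
letterWeight-≡ p (suc (suc k)) 0 _ _ = begin
  𝟙 (locallyNormal? p b 0) * 1ℤ  ≡⟨ ℤ.*-identityʳ _ ⟩
  𝟙 (locallyNormal? p b 0)
    ≡⟨ 𝟙-⇔ (λ (_ , _ , atStart) → decidable-stable (p ≟ b) (λ p≢b → atStart (s≤s (s≤s z≤n)) p≢b refl))
           (λ { refl → inj₂ (inj₂ refl) , (λ ()) , (λ _ p≢p → contradiction refl p≢p) })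
           (locallyNormal? p b 0) (p ≟ b) ⟩
  𝟙 (p ≟ b)                      ≡⟨ sym (trans (ℤ.+-identityˡ _) (ℤ.*-identityˡ _)) ⟩
  0ℤ - 0ℤ + 1ℤ * 𝟙 (p ≟ b)       ∎
  where b = suc (suc k)
letterWeight-≡ p (suc (suc k)) (suc i) _ (s≤s i≤k+1) with ℕ.m≤n⇒m<n∨m≡n i≤k+1
... | inj₂ refl = trans
  (cong₂ _*_ (𝟙-yes (locallyNormal? p b b) (inj₁ refl , (λ ()) , λ _ _ ()))
             (letterSign-≢ b b (ℕ.1+n≢n ∘ ℕ.suc-injective)))
  (sym (cong₂ (λ x y → x - y + 0ℤ) (𝟙-yes (b ≟ b) refl) (𝟙-no (b ≟ suc k) (ℕ.1+n≢n ∘ ℕ.suc-injective))))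
  where b = suc (suc k)
... | inj₁ (s≤s i≤k) with ℕ.m≤n⇒m<n∨m≡n i≤k
...   | inj₂ refl = trans
  (cong₂ _*_ (𝟙-yes (locallyNormal? p b (suc k)) (inj₂ (inj₁ refl) , (λ ()) , λ _ _ ()))
             (letterSign-≡ (suc k) b refl))
  (sym (cong₂ (λ x y → x - y + 0ℤ) (𝟙-no (suc k ≟ b) (ℕ.1+n≢n ∘ sym)) (𝟙-yes (suc k ≟ suc k) refl)))
  where b = suc (suc k)
...   | inj₁ i<k = trans
  (cong (_* letterSign (suc i) b) (𝟙-no (locallyNormal? p b (suc i)) λ
     { (inj₁ i+1≡b , _)          → ℕ.<⇒≢ (ℕ.m<n⇒m<1+n i<k) (ℕ.suc-injective i+1≡b)
     ; (inj₂ (inj₁ i+1≡b-1) , _) → ℕ.<⇒≢ i<k (ℕ.suc-injective i+1≡b-1) }))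
  (sym (cong₂ (λ x y → x - y + 0ℤ) (𝟙-no (suc i ≟ b) (ℕ.<⇒≢ (s≤s (ℕ.m<n⇒m<1+n i<k))))
                                   (𝟙-no (suc i ≟ suc k) (ℕ.<⇒≢ (s≤s i<k)))))
  where b = suc (suc k)

∑<-𝟙≟ : ∀ k x (g : ℕ → ℤ) → x < k → ∑[ i < k ] (𝟙 (i ≟ x) * g i) ≡ g x
∑<-𝟙≟ k x g x<k =
  trans (∑<-single k (λ i → 𝟙 (i ≟ x) * g i) x x<k (λ i i≢x → 𝟙-*-no (i ≟ x) i≢x (g i)))
        (𝟙-*-yes (x ≟ x) refl (g x))

∑<-letterWeight : ∀ p b (G : ℕ → ℤ) → 1 ≤ b →
  ∑[ e < suc b ] (letterWeight p b e * G e) ≡ G b - G (b ∸ 1) + 𝟙 (p ≟ b) * G 0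
∑<-letterWeight p b G 1≤b = begin
  ∑[ e < suc b ] (letterWeight p b e * G e)
    ≡⟨ ∑<-cong (suc b) (λ e e≤b → trans (cong (_* G e) (letterWeight-≡ p b e 1≤b (ℕ.≤-pred e≤b)))
                                        (expand (𝟙 (e ≟ b)) (𝟙 (e ≟ b ∸ 1)) (𝟙 (e ≟ 0)) (𝟙 (p ≟ b)) (G e))) ⟩
  ∑[ e < suc b ] (𝟙 (e ≟ b) * G e - 𝟙 (e ≟ b ∸ 1) * G e + 𝟙 (p ≟ b) * (𝟙 (e ≟ 0) * G e))
    ≡⟨ ∑<-+ (suc b) (λ e → 𝟙 (e ≟ b) * G e - 𝟙 (e ≟ b ∸ 1) * G e) (λ e → 𝟙 (p ≟ b) * (𝟙 (e ≟ 0) * G e)) ⟩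
  ∑[ e < suc b ] (𝟙 (e ≟ b) * G e - 𝟙 (e ≟ b ∸ 1) * G e) + ∑[ e < suc b ] (𝟙 (p ≟ b) * (𝟙 (e ≟ 0) * G e))
    ≡⟨ cong₂ _+_ (∑<-- (suc b) (λ e → 𝟙 (e ≟ b) * G e) (λ e → 𝟙 (e ≟ b ∸ 1) * G e))
                 (∑<-*ˡ (𝟙 (p ≟ b)) (suc b) (λ e → 𝟙 (e ≟ 0) * G e)) ⟩
  ∑[ e < suc b ] (𝟙 (e ≟ b) * G e) - ∑[ e < suc b ] (𝟙 (e ≟ b ∸ 1) * G e)
    + 𝟙 (p ≟ b) * ∑[ e < suc b ] (𝟙 (e ≟ 0) * G e)
    ≡⟨ cong₂ _+_ (cong₂ _-_ (∑<-𝟙≟ (suc b) b G ℕ.≤-refl) (∑<-𝟙≟ (suc b) (b ∸ 1) G (s≤s (ℕ.m∸n≤m b 1))))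
                 (cong (𝟙 (p ≟ b) *_) (∑<-𝟙≟ (suc b) 0 G (s≤s z≤n))) ⟩
  G b - G (b ∸ 1) + 𝟙 (p ≟ b) * G 0 ∎
  where
  expand : ∀ a c z q g → (a - c + z * q) * g ≡ a * g - c * g + q * (z * g)
  expand = solve-∀

∑<-𝟙≟suc : ∀ p b → ∑[ i < b ] 𝟙 (p ≟ suc i) ≡ 𝟙 ((1 ≤? p) ×-dec (p ≤? b))
∑<-𝟙≟suc zero    b = ∑<-vanish b (λ _ _ → refl)
∑<-𝟙≟suc (suc x) b with x <? b
... | yes x<b = trans (∑<-single b (λ i → 𝟙 (suc x ≟ suc i)) x x<b
                                 (λ i i≢x → 𝟙-no (suc x ≟ suc i) (i≢x ∘ sym ∘ ℕ.suc-injective)))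
                      (trans (𝟙-yes (suc x ≟ suc x) refl)
                             (sym (𝟙-yes ((1 ≤? suc x) ×-dec (suc x ≤? b)) (s≤s z≤n , x<b))))
... | no x≮b  = trans (∑<-vanish b (λ i i<b → 𝟙-no (suc x ≟ suc i) (λ { refl → x≮b i<b })))
                      (sym (𝟙-no ((1 ≤? suc x) ×-dec (suc x ≤? b)) (x≮b ∘ proj₂)))

∑<-∑<-letterWeight : ∀ p b (G : ℕ → ℤ) →
  ∑[ i < b ] ∑[ e < suc (suc i) ] (letterWeight p (suc i) e * G e)
  ≡ G b - G 0 + 𝟙 ((1 ≤? p) ×-dec (p ≤? b)) * G 0
∑<-∑<-letterWeight p b G = begin
  ∑[ i < b ] ∑[ e < suc (suc i) ] (letterWeight p (suc i) e * G e)
    ≡⟨ ∑<-cong b (λ i _ → ∑<-letterWeight p (suc i) G (s≤s z≤n)) ⟩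
  ∑[ i < b ] (G (suc i) - G i + 𝟙 (p ≟ suc i) * G 0)
    ≡⟨ ∑<-+ b (λ i → G (suc i) - G i) (λ i → 𝟙 (p ≟ suc i) * G 0) ⟩
  ∑[ i < b ] (G (suc i) - G i) + ∑[ i < b ] (𝟙 (p ≟ suc i) * G 0)
    ≡⟨ cong₂ _+_ (∑<-telescope b G)
                 (trans (∑<-*ʳ (G 0) b (λ i → 𝟙 (p ≟ suc i))) (cong (_* G 0) (∑<-𝟙≟suc p b))) ⟩
  G b - G 0 + 𝟙 ((1 ≤? p) ×-dec (p ≤? b)) * G 0 ∎

-- Lower sums of the signed counts

suffixCount : ℕ → Word → Word → ℤ
suffixCount p u []      = 0ℤ
suffixCount p u (c ∷ y) = 𝟙 ((1 ≤? p) ×-dec (p ≤? c)) * 𝟙 (u ≟w y) + suffixCount p u y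

suffixCount-0 : ∀ u w → suffixCount 0 u w ≡ 0ℤ
suffixCount-0 u []      = refl
suffixCount-0 u (c ∷ y) = trans (ℤ.+-identityˡ _) (suffixCount-0 u y)

∑W-≼∷ : ∀ m n b w (F : Word → ℤ) → b ≤ m →
  ∑W m (suc n) (λ v → 𝟙 (v ≼? (b ∷ w)) * F v)
  ≡ ∑W m (suc n) (λ v → 𝟙 (v ≼? w) * F v)
    + ∑[ i < b ] (∑W m n (λ v → 𝟙 (v ≼? w) * F (suc i ∷ v))
                  - ∑W m n (λ v → 𝟙 ((suc i ∷ v) ≼? w) * F (suc i ∷ v)))
∑W-≼∷ m n b w F b≤m = begin
  F[] + ∑[ i < m ] ∑W m n (λ v → 𝟙 ((suc i ∷ v) ≼? (b ∷ w)) * F (suc i ∷ v))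
    ≡⟨ cong (F[] +_) (∑<-cong m (λ i _ → byFirstLetter i (suc i ≤? b))) ⟩
  F[] + ∑[ i < m ] (B i + 𝟙 (suc i ≤? b) * (A i - B i))
    ≡⟨ cong (F[] +_) (∑<-+ m B (λ i → 𝟙 (suc i ≤? b) * (A i - B i))) ⟩
  F[] + (∑< m B + ∑[ i < m ] (𝟙 (suc i ≤? b) * (A i - B i)))
    ≡⟨ cong (λ z → F[] + (∑< m B + z)) onlyLettersUpTo-b ⟩
  F[] + (∑< m B + ∑[ i < b ] (A i - B i))
    ≡⟨ ℤ.+-assoc F[] (∑< m B) _ ⟨
  F[] + ∑< m B + ∑[ i < b ] (A i - B i) ∎
  where
  F[] = 1ℤ * F []
  A B : ℕ → ℤ
  A i = ∑W m n (λ v → 𝟙 (v ≼? w) * F (suc i ∷ v))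
  B i = ∑W m n (λ v → 𝟙 ((suc i ∷ v) ≼? w) * F (suc i ∷ v))
  byFirstLetter : ∀ i → (i<b? : Dec (suc i ≤ b)) →
    ∑W m n (λ v → 𝟙 ((suc i ∷ v) ≼? (b ∷ w)) * F (suc i ∷ v)) ≡ B i + 𝟙 i<b? * (A i - B i)
  byFirstLetter i (yes i<b) = trans
    (∑W-cong m n (λ v _ → cong (_* F (suc i ∷ v))
                                (𝟙-⇔ (∷≼∷⇒≼ i<b) (keep i<b) ((suc i ∷ v) ≼? (b ∷ w)) (v ≼? w))))
    (a≡b+1*[a-b] (A i) (B i))
    where
    a≡b+1*[a-b] : ∀ a b → a ≡ b + 1ℤ * (a - b)
    a≡b+1*[a-b] = solve-∀
  byFirstLetter i (no i≮b) = trans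
    (∑W-cong m n (λ v _ → cong (_* F (suc i ∷ v))
                                (𝟙-⇔ (∷≼∷⇒∷≼ i≮b) skip ((suc i ∷ v) ≼? (b ∷ w)) ((suc i ∷ v) ≼? w))))
    (sym (ℤ.+-identityʳ (B i)))
  onlyLettersUpTo-b : ∑[ i < m ] (𝟙 (suc i ≤? b) * (A i - B i)) ≡ ∑[ i < b ] (A i - B i)
  onlyLettersUpTo-b = trans
    (∑<-truncate m b _ b≤m (λ i b≤i → 𝟙-*-no (suc i ≤? b) (ℕ.≤⇒≯ b≤i) (A i - B i)))
    (∑<-cong b (λ i i<b → 𝟙-*-yes (suc i ≤? b) i<b (A i - B i)))

∑W-newlyBelow-normalSum : ∀ m n a w p u →
  (∀ u′ → ∑W m n (λ v → 𝟙 (v ≼? w) * normalSum a u′ v)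
          - ∑W m n (λ v → 𝟙 ((a ∷ v) ≼? w) * normalSum a u′ v) ≡ 𝟙 (u′ ≟w w)) →
  ∑W m n (λ v → 𝟙 (v ≼? w) * normalSum p u (a ∷ v)) - ∑W m n (λ v → 𝟙 ((a ∷ v) ≼? w) * normalSum p u (a ∷ v))
  ≡ ∑[ e < suc a ] (letterWeight p a e * peel e u (λ u′ → 𝟙 (u′ ≟w w)))
∑W-newlyBelow-normalSum m n a w p u newlyBelow = begin
  ∑W m n (λ v → 𝟙 (v ≼? w) * normalSum p u (a ∷ v)) - ∑W m n (λ v → 𝟙 ((a ∷ v) ≼? w) * normalSum p u (a ∷ v))
    ≡⟨ ∑W-distribʳ-- m n (λ v → 𝟙 (v ≼? w)) (λ v → 𝟙 ((a ∷ v) ≼? w)) (λ v → normalSum p u (a ∷ v)) ⟨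
  ∑W m n (λ v → c v * normalSum p u (a ∷ v))
    ≡⟨ ∑W-cong m n (λ v _ → expand v) ⟩
  ∑W m n (λ v → ∑[ e < suc a ] (letterWeight p a e * (c v * peel e u (λ u′ → normalSum a u′ v))))
    ≡⟨ ∑W-∑< m n (suc a) (λ e v → letterWeight p a e * (c v * peel e u (λ u′ → normalSum a u′ v))) ⟩
  ∑[ e < suc a ] ∑W m n (λ v → letterWeight p a e * (c v * peel e u (λ u′ → normalSum a u′ v)))
    ≡⟨ ∑<-cong (suc a) (λ e _ →
         trans (∑W-*ˡ m n (letterWeight p a e) _)
               (cong (letterWeight p a e *_) (∑W-peel m n e u c (λ u′ v → normalSum a u′ v)))) ⟩
  ∑[ e < suc a ] (letterWeight p a e * peel e u (λ u′ → ∑W m n (λ v → c v * normalSum a u′ v)))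
    ≡⟨ ∑<-cong (suc a) (λ e _ → cong (letterWeight p a e *_) (peel-cong e u λ u′ →
         trans (∑W-distribʳ-- m n (λ v → 𝟙 (v ≼? w)) (λ v → 𝟙 ((a ∷ v) ≼? w)) (normalSum a u′))
               (newlyBelow u′))) ⟩
  ∑[ e < suc a ] (letterWeight p a e * peel e u (λ u′ → 𝟙 (u′ ≟w w))) ∎
  where
  c : Word → ℤ
  c v = 𝟙 (v ≼? w) - 𝟙 ((a ∷ v) ≼? w)
  expand : ∀ v → c v * normalSum p u (a ∷ v)
               ≡ ∑[ e < suc a ] (letterWeight p a e * (c v * peel e u (λ u′ → normalSum a u′ v)))
  expand v = begin
    c v * normalSum p u (a ∷ v)
      ≡⟨ cong (c v *_) (normalSum-∷ p u a v) ⟩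
    c v * ∑[ e < suc a ] (letterWeight p a e * peel e u (λ u′ → normalSum a u′ v))
      ≡⟨ ∑<-*ˡ (c v) (suc a) (λ e → letterWeight p a e * peel e u (λ u′ → normalSum a u′ v)) ⟨
    ∑[ e < suc a ] (c v * (letterWeight p a e * peel e u (λ u′ → normalSum a u′ v)))
      ≡⟨ ∑<-cong (suc a) (λ e _ →
           ℤ*.x∙yz≈y∙xz (c v) (letterWeight p a e) (peel e u (λ u′ → normalSum a u′ v))) ⟩
    ∑[ e < suc a ] (letterWeight p a e * (c v * peel e u (λ u′ → normalSum a u′ v))) ∎

module _ (m : ℕ) where

  ∑W-≼-normalSum : ∀ n w → length w ≤ n → Composition w → Bounded m w → ∀ p u →
    ∑W m n (λ v → 𝟙 (v ≼? w) * normalSum p u v) ≡ 𝟙 (u ≟w w) + suffixCount p u w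

  ∑W-∷≼-normalSum : ∀ n a y → 1 ≤ a → length y ≤ n → Composition y → Bounded m y → ∀ u →
    ∑W m n (λ v → 𝟙 ((a ∷ v) ≼? y) * normalSum a u v) ≡ suffixCount a u y

  ∑W-≼-normalSum n [] _ _ _ p u = begin
    ∑W m n (λ v → 𝟙 (v ≼? []) * normalSum p u v)
      ≡⟨ ∑W-single m n _ [] [] [] z≤n (λ { [] []≢[] → contradiction refl []≢[] ; (_ ∷ _) _ → refl }) ⟩
    1ℤ * normalSum p u []  ≡⟨ ℤ.*-identityˡ _ ⟩
    normalSum p u []       ≡⟨ normalSum-[] p u ⟩
    𝟙 (u ≟w [])            ≡⟨ ℤ.+-identityʳ _ ⟨
    𝟙 (u ≟w []) + 0ℤ       ∎
  ∑W-≼-normalSum (suc n) (suc b′ ∷ w) (s≤s ∣w∣≤n) (_ ∷ cw) (b≤m ∷ bw) p u = begin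
    ∑W m (suc n) (λ v → 𝟙 (v ≼? (b ∷ w)) * normalSum p u v)
      ≡⟨ ∑W-≼∷ m n b w (normalSum p u) b≤m ⟩
    ∑W m (suc n) (λ v → 𝟙 (v ≼? w) * normalSum p u v)
      + ∑[ i < b ] (∑W m n (λ v → 𝟙 (v ≼? w) * normalSum p u (suc i ∷ v))
                    - ∑W m n (λ v → 𝟙 ((suc i ∷ v) ≼? w) * normalSum p u (suc i ∷ v)))
      ≡⟨ cong₂ _+_ (trans (∑W-lift m n _ shortWords) (∑W-≼-normalSum n w ∣w∣≤n cw bw p u))
                   (∑<-cong b (λ i _ →
                      ∑W-newlyBelow-normalSum m n (suc i) w p u (newlyBelow (suc i) (s≤s z≤n)))) ⟩
    δ + suffixCount p u w + ∑[ i < b ] ∑[ e < suc (suc i) ] (letterWeight p (suc i) e * G e)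
      ≡⟨ cong (δ + suffixCount p u w +_)
              (trans (∑<-∑<-letterWeight p b G) (cong (λ z → z - δ + first * δ) (peel-≟ b′ u w))) ⟩
    δ + suffixCount p u w + (𝟙 (u ≟w (b ∷ w)) - δ + first * δ)
      ≡⟨ rearrange δ (suffixCount p u w) (𝟙 (u ≟w (b ∷ w))) (first * δ) ⟩
    𝟙 (u ≟w (b ∷ w)) + (first * δ + suffixCount p u w) ∎
    where
    b = suc b′
    δ = 𝟙 (u ≟w w)
    first = 𝟙 ((1 ≤? p) ×-dec (p ≤? b))
    G : ℕ → ℤ
    G e = peel e u (λ u′ → 𝟙 (u′ ≟w w))
    shortWords : ∀ v → n < length v → 𝟙 (v ≼? w) * normalSum p u v ≡ 0ℤ
    shortWords v n<∣v∣ = 𝟙-*-no (v ≼? w) (λ v≼w → ℕ.<⇒≱ n<∣v∣ (ℕ.≤-trans (≼-length v≼w) ∣w∣≤n)) _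
    x+y-y≡x : ∀ x y → x + y - y ≡ x
    x+y-y≡x = solve-∀
    newlyBelow : ∀ a → 1 ≤ a → ∀ u′ →
      ∑W m n (λ v → 𝟙 (v ≼? w) * normalSum a u′ v) - ∑W m n (λ v → 𝟙 ((a ∷ v) ≼? w) * normalSum a u′ v)
      ≡ 𝟙 (u′ ≟w w)
    newlyBelow a 1≤a u′ = trans
      (cong₂ _-_ (∑W-≼-normalSum n w ∣w∣≤n cw bw a u′) (∑W-∷≼-normalSum n a w 1≤a ∣w∣≤n cw bw u′))
      (x+y-y≡x (𝟙 (u′ ≟w w)) (suffixCount a u′ w))
    rearrange : ∀ x s y t → x + s + (y - x + t) ≡ y + (t + s)
    rearrange = solve-∀

  ∑W-∷≼-normalSum n a [] _ _ _ _ u = ∑W-vanish m n (λ _ → refl)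
  ∑W-∷≼-normalSum n a (c ∷ y) 1≤a ∣cy∣≤n (_ ∷ cy) (_ ∷ by) u = byHead (a ≤? c)
    where
    ∣y∣≤n = ℕ.≤-trans (ℕ.n≤1+n _) ∣cy∣≤n
    byHead : Dec (a ≤ c) →
      ∑W m n (λ v → 𝟙 ((a ∷ v) ≼? (c ∷ y)) * normalSum a u v) ≡ suffixCount a u (c ∷ y)
    byHead (yes a≤c) = begin
      ∑W m n (λ v → 𝟙 ((a ∷ v) ≼? (c ∷ y)) * normalSum a u v)
        ≡⟨ ∑W-cong m n (λ v _ → cong (_* normalSum a u v)
                                     (𝟙-⇔ (∷≼∷⇒≼ a≤c) (keep a≤c) ((a ∷ v) ≼? (c ∷ y)) (v ≼? y))) ⟩
      ∑W m n (λ v → 𝟙 (v ≼? y) * normalSum a u v)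
        ≡⟨ ∑W-≼-normalSum n y ∣y∣≤n cy by a u ⟩
      𝟙 (u ≟w y) + suffixCount a u y
        ≡⟨ cong (_+ suffixCount a u y) (𝟙-*-yes ((1 ≤? a) ×-dec (a ≤? c)) (1≤a , a≤c) (𝟙 (u ≟w y))) ⟨
      suffixCount a u (c ∷ y) ∎
    byHead (no a≰c) = begin
      ∑W m n (λ v → 𝟙 ((a ∷ v) ≼? (c ∷ y)) * normalSum a u v)
        ≡⟨ ∑W-cong m n (λ v _ → cong (_* normalSum a u v)
                                     (𝟙-⇔ (∷≼∷⇒∷≼ a≰c) skip ((a ∷ v) ≼? (c ∷ y)) ((a ∷ v) ≼? y))) ⟩
      ∑W m n (λ v → 𝟙 ((a ∷ v) ≼? y) * normalSum a u v)
        ≡⟨ ∑W-∷≼-normalSum n a y 1≤a ∣y∣≤n cy by u ⟩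
      suffixCount a u y
        ≡⟨ trans (cong (_+ suffixCount a u y) (𝟙-*-no ((1 ≤? a) ×-dec (a ≤? c)) (a≰c ∘ proj₂) _))
                 (ℤ.+-identityˡ _) ⟨
      suffixCount a u (c ∷ y) ∎

lowerSum-normalSum : ∀ u w → Composition w →
  ∑W (maxL w) (length w) (λ v → 𝟙 (v ≼? w) * normalSum 0 u v) ≡ 𝟙 (u ≟w w)
lowerSum-normalSum u w cw = begin
  ∑W (maxL w) (length w) (λ v → 𝟙 (v ≼? w) * normalSum 0 u v)
    ≡⟨ ∑W-≼-normalSum (maxL w) (length w) w ℕ.≤-refl cw (maxL-bounded w) 0 u ⟩
  𝟙 (u ≟w w) + suffixCount 0 u w  ≡⟨ cong (𝟙 (u ≟w w) +_) (suffixCount-0 u w) ⟩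
  𝟙 (u ≟w w) + 0ℤ                 ≡⟨ ℤ.+-identityʳ _ ⟩
  𝟙 (u ≟w w)                      ∎

theorem1p2 : (u w : Word) → Composition u → Composition w → u ≼ w →
    (L : List Word) → Unique L → (∀ η → (η ∈ L) ⇔ IsNormalEmbedding u w η) →
    μ u w ≡ sumℤ (map (λ η → sign (defect η w)) L)
theorem1p2 u w _ cw u≼w L unique L⇔normal = begin
  μ u w
    ≡⟨ μ-unique u (normalSum 0 u) (normalSum-vanish 0 u) (lowerSum-normalSum u) w cw u≼w ⟩
  normalSum 0 u w
    ≡⟨ sumℤ-normalEmbeddings u w L unique L⇔normal ⟨
  sumℤ (map (λ η → sign (defect η w)) L) ∎
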